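{- Let $m$ be a positive integer, let $B\subseteq m\mathbb Z$ be a finite nonempty set, and let $F\subseteq\mathbb Z$ be a finite nonempty set all of whose elements are congruent modulo $m$ to a single $\tilde f\in\{1,\dots,m-1\}$. Suppose there are a positive integer $n$ and sets $S_1,\dots,S_n\subseteq\mathbb Z$ with $S_1\cup\dots\cup S_n=m\mathbb N\cup B$ such that for each $i$ there exists $W_i\subseteq\mathbb Z$ with $m\mathbb Z\setminus S_i=F+W_i$. If \[m\ge \tilde f+2\tilde f\left\lfloor\frac{n}{\tilde f}\right\rfloor+\operatorname{mod}_{\tilde f}n,\] then $C=m\mathbb N\cup B\cup F$ arises as a minimal additive complement in $\mathbb Z$.
   Context: $\mathbb N=\{0,1,2,\dots\}$; $\operatorname{mod}_k n$ denotes the remainder of $n$ upon division by $k$. For subsets $C,W$ of $\mathbb Z$, $C+W=\{c+w:c\in C,w\in W\}$. $C$ is a minimal additive complement (MAC) to $W$ if $C+W=\mathbb Z$ and no proper subset $C'\subsetneq C$ satisfies $C'+W=\mathbb Z$. $C$ arises as a MAC if there exists some $W\subseteq\mathbb Z$ to which $C$ is a MAC. -}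

module Defs where

open import Data.Nat using (ℕ)
open import Data.Integer using (ℤ; +_; _+_; _*_)
open import Data.Product using (Σ; ∃; _×_)
open import Data.Empty using (⊥)
open import Relation.Nullary using (¬_)
open import Relation.Binary.PropositionalEquality using (_≡_)

SubsetZ : Set₁
SubsetZ = ℤ → Set

multZ : ℕ → SubsetZ
multZ m z = Σ ℤ (λ k → z ≡ (+ m) * k)

multN : ℕ → SubsetZ
multN m z = Σ ℕ (λ k → z ≡ (+ m) * (+ k))

_⊕_ : SubsetZ → SubsetZ → SubsetZ
(C ⊕ W) z = Σ ℤ (λ c → Σ ℤ (λ w → C c × W w × z ≡ c + w))

_⊆_ : SubsetZ → SubsetZ → Set
A ⊆ B = ∀ z → A z → B z

Covers : SubsetZ → SubsetZ → Set
Covers C W = ∀ z → (C ⊕ W) z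

IsMAC : SubsetZ → SubsetZ → Set₁
IsMAC C W = Covers C W ×
  ((C' : SubsetZ) → ¬ (C' ⊆ C × Σ ℤ (λ c → C c × ¬ C' c) × Covers C' W))

ArisesAsMAC : SubsetZ → Set₁
ArisesAsMAC C = Σ SubsetZ (λ W → IsMAC C W)

-- With s i = slot i and r i = s i + f̃ for i < n, the bound on m makes the 2n numbers s i, r i
-- pairwise incongruent modulo m. Let W consist of the r i, the shifts r i + y with y either an
-- element of W_i above a threshold L or an element of a set Y ⊆ −f̃ + mℤ of very negative numbers,
-- and every integer congruent to no s i, r i. Then z ≡ r i is covered by mℕ ∪ B or, through
-- F + W_i = mℤ ∖ S_i, by F + r i + (W_i ∪ Y), where Y takes over the multiples of m that W_i reaches
-- below L; z ≡ s i is covered by mℕ + r i + Y, and every other z by 0 + W. For minimality, c ∈ S_i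
-- is the only element of C reaching r i + c, because any other representation would put c into
-- F + W_i or below min (mℕ ∪ B); and e ∈ F is the only one reaching r i₀ + e + partner e, because
-- the partners in Y are spread so far apart that e + partner e has no other representation in F + Y.

module Submission where

open import Data.Nat as ℕ using (ℕ; NonZero)
open import Data.Integer as ℤ using (ℤ; +_)
open import Data.Fin using (Fin; toℕ)
open import Data.List using (List)
open import Data.List.Membership.Propositional using (_∈_)
open import Data.Product using (Σ; _×_)
open import Data.Sum using (_⊎_)
open import Relation.Nullary using (¬_)
open import Defs

module Slots (ft : ℕ) .{{_ : NonZero ft}} where
  open import Data.Nat
  open import Data.Nat.Properties
  open import Data.Nat.DivMod
  open import Data.Nat.Divisibility using (divides-refl)
  open import Data.Nat.Tactic.RingSolver using (solve-∀)
  open import Relation.Binary.Definitions using (tri<; tri≈; tri>)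
  open import Relation.Binary.PropositionalEquality
  open import Relation.Nullary using (contradiction)

  -- slot enumerates the naturals in the even blocks [2k ft, (2k+1) ft); adding ft lands in an odd block.
  slot : ℕ → ℕ
  slot i = i + i / ft * ft

  slot-<-mono : ∀ {x y} → x < y → slot x < slot y
  slot-<-mono x<y = +-mono-<-≤ x<y (*-monoˡ-≤ ft (/-monoˡ-≤ ft (<⇒≤ x<y)))

  slot-injective : ∀ {x y} → slot x ≡ slot y → x ≡ y
  slot-injective {x} {y} eq with <-cmp x y
  ... | tri< x<y _ _ = contradiction eq (<⇒≢ (slot-<-mono x<y))
  ... | tri≈ _ x≡y _ = x≡y
  ... | tri> _ _ y<x = contradiction (sym eq) (<⇒≢ (slot-<-mono y<x))

  slot≡ : ∀ x → slot x ≡ x % ft + 2 * (x / ft) * ft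
  slot≡ x = begin
    x + x / ft * ft                   ≡⟨ cong (_+ x / ft * ft) (m≡m%n+[m/n]*n x ft) ⟩
    x % ft + x / ft * ft + x / ft * ft ≡⟨ double (x % ft) (x / ft) ft ⟩
    x % ft + 2 * (x / ft) * ft        ∎
    where
    open ≡-Reasoning
    double : ∀ r q f → r + q * f + q * f ≡ r + 2 * q * f
    double = solve-∀

  [r+q*ft]/ft≡q : ∀ {r} q → r < ft → (r + q * ft) / ft ≡ q
  [r+q*ft]/ft≡q {r} q r<ft = begin
    (r + q * ft) / ft       ≡⟨ +-distrib-/-∣ʳ r (divides-refl q) ⟩
    r / ft + q * ft / ft    ≡⟨ cong₂ _+_ (m<n⇒m/n≡0 r<ft) (m*n/n≡m q ft) ⟩
    q                       ∎
    where open ≡-Reasoning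

  slot+ft≢slot : ∀ x y → slot x + ft ≢ slot y
  slot+ft≢slot x y eq = even≢odd (y / ft) (x / ft) (begin
    2 * (y / ft)                             ≡⟨ [r+q*ft]/ft≡q _ (m%n<n y ft) ⟨
    (y % ft + 2 * (y / ft) * ft) / ft        ≡⟨ cong (_/ ft) (trans (sym (slot≡ y)) (sym eq)) ⟩
    (slot x + ft) / ft                       ≡⟨ cong (λ s → (s + ft) / ft) (slot≡ x) ⟩
    (x % ft + 2 * (x / ft) * ft + ft) / ft   ≡⟨ cong (_/ ft) (shift (x % ft) (x / ft) ft) ⟩
    (x % ft + suc (2 * (x / ft)) * ft) / ft  ≡⟨ [r+q*ft]/ft≡q _ (m%n<n x ft) ⟩
    suc (2 * (x / ft))                       ∎)
    where
    open ≡-Reasoning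
    shift : ∀ r q f → r + 2 * q * f + f ≡ r + suc (2 * q) * f
    shift = solve-∀

  slot+ft<bound : ∀ {x n} → x < n → slot x + ft < ft + 2 * ft * (n / ft) + n % ft
  slot+ft<bound {x} {n} x<n = begin-strict
    slot x + ft                     <⟨ +-monoˡ-< ft (slot-<-mono x<n) ⟩
    slot n + ft                     ≡⟨ cong (_+ ft) (slot≡ n) ⟩
    n % ft + 2 * (n / ft) * ft + ft ≡⟨ reorder (n % ft) (n / ft) ft ⟩
    ft + 2 * ft * (n / ft) + n % ft ∎
    where
    open ≤-Reasoning
    reorder : ∀ r q f → r + 2 * q * f + f ≡ f + 2 * f * q + r
    reorder = solve-∀

module NonNegativity where
  open import Data.Nat using (suc)
  open import Data.Integer hiding (suc; NonZero)
  open import Data.Integer.Properties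
  open import Data.Integer.Tactic.RingSolver using (solve-∀)
  open import Data.Product using (_,_)
  open import Relation.Binary.PropositionalEquality

  NonNeg : ℤ → Set
  NonNeg x = Σ ℕ λ k → x ≡ + k

  nonNeg-ℕ : ∀ k → NonNeg (+ k)
  nonNeg-ℕ k = k , refl

  nonNeg-+ : ∀ {x y} → NonNeg x → NonNeg y → NonNeg (x + y)
  nonNeg-+ (k , refl) (l , refl) = k ℕ.+ l , sym (pos-+ k l)

  nonNeg-* : ∀ {x y} → NonNeg x → NonNeg y → NonNeg (x * y)
  nonNeg-* (k , refl) (l , refl) = k ℕ.* l , sym (pos-* k l)

  ≤⇒nonNeg : ∀ {x y} → x ≤ y → NonNeg (y - x)
  ≤⇒nonNeg x≤y = _ , sym (0≤i⇒+∣i∣≡i (i≤j⇒0≤j-i x≤y))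

  nonNeg⇒≤ : ∀ {x y} → NonNeg (y - x) → x ≤ y
  nonNeg⇒≤ (k , eq) = 0≤i-j⇒j≤i (subst (0ℤ ≤_) (sym eq) (+≤+ ℕ.z≤n))

  <⇒nonNeg : ∀ {x y} → x < y → NonNeg (y - x - 1ℤ)
  <⇒nonNeg {x} {y} x<y = subst NonNeg (reassoc x y) (≤⇒nonNeg (i<j⇒suc[i]≤j x<y))
    where
    reassoc : ∀ x y → y - (1ℤ + x) ≡ y - x - 1ℤ
    reassoc = solve-∀

  nonNeg⇒< : ∀ {x y} → NonNeg (y - x - 1ℤ) → x < y
  nonNeg⇒< {x} {y} d = suc[i]≤j⇒i<j (nonNeg⇒≤ (subst NonNeg (reassoc x y) d))
    where
    reassoc : ∀ x y → y - x - 1ℤ ≡ y - (1ℤ + x)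
    reassoc = solve-∀

  ≤-from : ∀ {x y d} → NonNeg d → d ≡ y - x → x ≤ y
  ≤-from d≥0 eq = nonNeg⇒≤ (subst NonNeg eq d≥0)

  <-from : ∀ {x y d} → NonNeg d → d ≡ y - x - 1ℤ → x < y
  <-from d≥0 eq = nonNeg⇒< (subst NonNeg eq d≥0)

  ¬nonNeg-[-1-x] : ∀ {x} → NonNeg x → ¬ NonNeg (- 1ℤ - x)
  ¬nonNeg-[-1-x] (k , refl) (l , eq) = +≢-1 (begin
    + (k ℕ.+ l)         ≡⟨ pos-+ k l ⟩
    + k + + l           ≡⟨ cong (_+_ (+ k)) eq ⟨
    + k + (- 1ℤ - + k)  ≡⟨ cancel (+ k) ⟩
    - 1ℤ                ∎)
    where
    open ≡-Reasoning
    cancel : ∀ x → x + (- 1ℤ - x) ≡ - 1ℤ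
    cancel = solve-∀
    +≢-1 : ∀ {n} → + n ≢ - 1ℤ
    +≢-1 ()

  nonNeg-∣x∣-x : ∀ x → NonNeg (+ ∣ x ∣ - x)
  nonNeg-∣x∣-x (+ k)    = 0 , +-inverseʳ (+ k)
  nonNeg-∣x∣-x -[1+ k ] = suc k ℕ.+ suc k , trans (double (+ suc k)) (sym (pos-+ (suc k) (suc k)))
    where
    double : ∀ x → x - (- x) ≡ x + x
    double = solve-∀

module Congruence (m : ℕ) .{{_ : NonZero m}} where
  open import Data.Nat using (zero; suc)
  import Data.Nat.Properties as ℕ
  open import Data.Integer hiding (suc; NonZero)
  open import Data.Integer.Properties
  open import Data.Integer.DivMod using (_%ℕ_; _/ℕ_; n%ℕd<d; a≡a%ℕn+[a/ℕn]*n)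
  open import Data.Integer.Tactic.RingSolver using (solve-∀)
  open import Data.Product using (_,_)
  open import Function using (_∘_)
  open import Relation.Binary.Bundles using (Setoid)
  open import Relation.Binary.Definitions using (Decidable)
  open import Relation.Binary.Structures using (IsEquivalence)
  open import Relation.Nullary using (yes; no; contradiction)
  open import Relation.Binary.PropositionalEquality
  import Relation.Binary.Reasoning.Setoid
  open NonNegativity

  multZ-+ : ∀ {x y} → multZ m x → multZ m y → multZ m (x + y)
  multZ-+ (k , refl) (l , refl) = k + l , sym (*-distribˡ-+ (+ m) k l)

  multZ-*ˡ : ∀ c {x} → multZ m x → multZ m (c * x)
  multZ-*ˡ c (k , refl) = c * k , swap c (+ m) k
    where
    swap : ∀ c x k → c * (x * k) ≡ x * (c * k)
    swap = solve-∀

  multZ-neg : ∀ {x} → multZ m x → multZ m (- x)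
  multZ-neg (k , refl) = - k , neg-distribʳ-* (+ m) k

  infix 4 _≈_ _≈?_

  -- A record rather than a synonym for multZ m (x - y), so that x and y stay inferable.
  record _≈_ (x y : ℤ) : Set where
    constructor mk≈
    field multZ-diff : multZ m (x - y)

  open _≈_ public

  multZ⇒≈0 : ∀ {x} → multZ m x → x ≈ 0ℤ
  multZ⇒≈0 {x} = mk≈ ∘ subst (multZ m) (sym (+-identityʳ x))

  ≈0⇒multZ : ∀ {x} → x ≈ 0ℤ → multZ m x
  ≈0⇒multZ {x} = subst (multZ m) (+-identityʳ x) ∘ multZ-diff

  ≈-reflexive : ∀ {x y} → x ≡ y → x ≈ y
  ≈-reflexive {x} refl = mk≈ (0ℤ , trans (+-inverseʳ x) (sym (*-zeroʳ (+ m))))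

  ≈-sym : ∀ {x y} → x ≈ y → y ≈ x
  ≈-sym {x} {y} (mk≈ p) = mk≈ (subst (multZ m) (flip x y) (multZ-neg p))
    where
    flip : ∀ x y → - (x - y) ≡ y - x
    flip = solve-∀

  ≈-trans : ∀ {x y z} → x ≈ y → y ≈ z → x ≈ z
  ≈-trans {x} {y} {z} (mk≈ p) (mk≈ q) = mk≈ (subst (multZ m) (telescope x y z) (multZ-+ p q))
    where
    telescope : ∀ x y z → (x - y) + (y - z) ≡ x - z
    telescope = solve-∀

  ≈-isEquivalence : IsEquivalence _≈_
  ≈-isEquivalence = record { refl = ≈-reflexive refl ; sym = ≈-sym ; trans = ≈-trans }

  ≈-setoid : Setoid _ _
  ≈-setoid = record { isEquivalence = ≈-isEquivalence }

  module ≈-Reasoning = Relation.Binary.Reasoning.Setoid ≈-setoid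

  ≈-+ : ∀ {x y u v} → x ≈ y → u ≈ v → x + u ≈ y + v
  ≈-+ {x} {y} {u} {v} (mk≈ p) (mk≈ q) = mk≈ (subst (multZ m) (interchange x y u v) (multZ-+ p q))
    where
    interchange : ∀ x y u v → (x - y) + (u - v) ≡ (x + u) - (y + v)
    interchange = solve-∀

  ≈-sub : ∀ {x y u v} → x ≈ y → u ≈ v → x - u ≈ y - v
  ≈-sub {x} {y} {u} {v} (mk≈ p) (mk≈ q) = mk≈ (subst (multZ m) (interchange x y u v) (multZ-+ p (multZ-neg q)))
    where
    interchange : ∀ x y u v → (x - y) + - (u - v) ≡ (x - u) - (y - v)
    interchange = solve-∀

  ≈-+-absorbʳ : ∀ x {t} → t ≈ 0ℤ → x + t ≈ x
  ≈-+-absorbʳ x t≈0 = ≈-trans (≈-+ (≈-reflexive {x} refl) t≈0) (≈-reflexive (+-identityʳ x))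

  ≈-subtract : ∀ {x u w v} → x ≈ u → x + w ≈ v → w ≈ v - u
  ≈-subtract {x} {u} {w} {v} x≈u x+w≈v = ≈-trans (≈-reflexive (isolate x w)) (≈-sub x+w≈v x≈u)
    where
    isolate : ∀ x w → w ≡ x + w - x
    isolate = solve-∀

  ≈-*ˡ : ∀ c {x y} → x ≈ y → c * x ≈ c * y
  ≈-*ˡ c {x} {y} (mk≈ p) = mk≈ (subst (multZ m) (distrib c x y) (multZ-*ˡ c p))
    where
    distrib : ∀ c x y → c * (x - y) ≡ c * x - c * y
    distrib = solve-∀

  m*k≈0 : ∀ k → + m * k ≈ 0ℤ
  m*k≈0 k = multZ⇒≈0 (k , refl)

  private
    m*k<m⇒k≡0 : ∀ k → m ℕ.* k ℕ.< m → k ≡ 0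
    m*k<m⇒k≡0 zero    _ = refl
    m*k<m⇒k≡0 (suc k) mk<m = contradiction (ℕ.m≤m*n m (suc k)) (ℕ.<⇒≱ mk<m)

  residue-unique : ∀ {u v} → u ℕ.< m → v ℕ.< m → + u ≈ + v → u ≡ v
  residue-unique {u} {v} u<m v<m (mk≈ (k , eq)) = +-injective (begin
    + u               ≡⟨ shift (+ u) (+ v) ⟩
    (+ u - + v) + + v ≡⟨ cong (_+ + v) u-v≡0 ⟩
    0ℤ + + v          ≡⟨ +-identityˡ (+ v) ⟩
    + v               ∎)
    where
    open ≡-Reasoning
    shift : ∀ x y → x ≡ (x - y) + y
    shift = solve-∀
    ∣u-v∣<m : ∣ + u - + v ∣ ℕ.< m
    ∣u-v∣<m = ℕ.≤-<-trans (subst (λ z → ∣ z ∣ ℕ.≤ u ℕ.⊔ v) (sym (m-n≡m⊖n u v)) (∣m⊝n∣≤m⊔n u v))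
                          (ℕ.⊔-lub u<m v<m)
    ∣k∣≡0 : ∣ k ∣ ≡ 0
    ∣k∣≡0 = m*k<m⇒k≡0 ∣ k ∣ (subst (ℕ._< m) (trans (cong ∣_∣ eq) (∣i*j∣≡∣i∣*∣j∣ (+ m) k)) ∣u-v∣<m)
    u-v≡0 : + u - + v ≡ 0ℤ
    u-v≡0 = trans eq (trans (cong (+ m *_) (∣i∣≡0⇒i≡0 ∣k∣≡0)) (*-zeroʳ (+ m)))

  remainder≈ : ∀ z → + (z %ℕ m) ≈ z
  remainder≈ z = begin
    + (z %ℕ m)                  ≈⟨ ≈-+-absorbʳ (+ (z %ℕ m)) (m*k≈0 (z /ℕ m)) ⟨
    + (z %ℕ m) + + m * (z /ℕ m) ≡⟨ cong (_+_ (+ (z %ℕ m))) (*-comm (+ m) (z /ℕ m)) ⟩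
    + (z %ℕ m) + z /ℕ m * + m   ≡⟨ a≡a%ℕn+[a/ℕn]*n z m ⟨
    z                           ∎
    where open ≈-Reasoning

  _≈?_ : Decidable _≈_
  x ≈? y with (x - y) %ℕ m ℕ.≟ 0
  ... | yes r≡0 = yes (mk≈ (≈0⇒multZ (≈-trans (≈-sym (remainder≈ (x - y))) (≈-reflexive (cong +_ r≡0)))))
  ... | no r≢0  = no λ x≈y → r≢0 (residue-unique (n%ℕd<d (x - y) m) (ℕ.>-nonZero⁻¹ m)
                                    (≈-trans (remainder≈ (x - y)) (multZ⇒≈0 (multZ-diff x≈y))))

  multN⇒0≤ : ∀ {z} → multN m z → 0ℤ ≤ z
  multN⇒0≤ (k , refl) = subst (0ℤ ≤_) (pos-* m k) (+≤+ ℕ.z≤n)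

  0≤∧multZ⇒multN : ∀ {z} → 0ℤ ≤ z → multZ m z → multN m z
  0≤∧multZ⇒multN _   (+ k , eq)        = k , eq
  0≤∧multZ⇒multN 0≤z (-[1+ k ] , refl) = contradiction 0≤z (¬0≤m*neg m)
    where
    ¬0≤m*neg : ∀ m' .{{_ : NonZero m'}} → ¬ (0ℤ ≤ + m' * -[1+ k ])
    ¬0≤m*neg (suc _) ()

  multiple-below : ∀ x c → Σ ℕ λ k → x - + m * + k < c
  multiple-below x c = k , <-from cert (gap (+ m) x c (+ ∣ x ∣) (+ ∣ - c ∣) (+ k) +k≡)
    where
    k : ℕ
    k = ∣ x ∣ ℕ.+ ∣ - c ∣ ℕ.+ 1
    +k≡ : + k ≡ + ∣ x ∣ + + ∣ - c ∣ + 1ℤ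
    +k≡ = trans (pos-+ (∣ x ∣ ℕ.+ ∣ - c ∣) 1) (cong (_+ 1ℤ) (pos-+ ∣ x ∣ ∣ - c ∣))
    cert : NonNeg ((+ m - 1ℤ) * + k + (+ ∣ x ∣ - x) + (+ ∣ - c ∣ - - c))
    cert = nonNeg-+ (nonNeg-+ (nonNeg-* (≤⇒nonNeg (+≤+ (ℕ.>-nonZero⁻¹ m))) (nonNeg-ℕ k)) (nonNeg-∣x∣-x x)) (nonNeg-∣x∣-x (- c))
    gap : ∀ M x c A B K → K ≡ A + B + 1ℤ → (M - 1ℤ) * K + (A - x) + (B - - c) ≡ c - (x - M * K) - 1ℤ
    gap M x c A B K refl = gap′ M x c A B
      where
      gap′ : ∀ M x c A B → (M - 1ℤ) * (A + B + 1ℤ) + (A - x) + (B - - c) ≡ c - (x - M * (A + B + 1ℤ)) - 1ℤ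
      gap′ = solve-∀

module MinimalComplements where
  open import Data.Integer using (_+_)
  open import Data.Product using (_,_)
  open import Relation.Binary.PropositionalEquality using (_≡_; subst)

  Essential : SubsetZ → SubsetZ → ℤ → Set
  Essential C W c = Σ ℤ λ z → ∀ {c' w} → C c' → W w → z ≡ c' + w → c' ≡ c

  isMAC-if-essential : ∀ {C W} → Covers C W → (∀ {c} → C c → Essential C W c) → IsMAC C W
  isMAC-if-essential {C} {W} covers essential = covers , minimal
    where
    minimal : ∀ C' → ¬ (C' ⊆ C × Σ ℤ (λ c → C c × ¬ C' c) × Covers C' W)
    minimal C' (C'⊆C , (c , c∈C , c∉C') , covers') with essential c∈C
    ... | z , only-c with covers' z
    ... | c' , w , c'∈C' , w∈W , z≡ = c∉C' (subst C' (only-c (C'⊆C c' c'∈C') w∈W z≡) c'∈C')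

module Sieve (m : ℕ) .{{_ : NonZero m}} (ft : ℕ) .{{_ : NonZero ft}}
  (F : List ℤ) {a b : ℤ} (a∈F : a ∈ F) (b∈F : b ∈ F)
  (a≤ : ∀ {f} → f ∈ F → a ℤ.≤ f) (≤b : ∀ {f} → f ∈ F → f ℤ.≤ b)
  (F≈ft : ∀ {f} → f ∈ F → Congruence._≈_ m f (+ ft)) (β : ℤ) where
  open import Data.Integer hiding (suc; NonZero)
  open import Data.Integer.Properties
  open import Data.Integer.Tactic.RingSolver using (solve-∀)
  open import Data.List.Relation.Unary.Any using (Any; any?)
  open import Data.List.Membership.Propositional using (find; lose)
  open import Data.Product using (_,_)
  open import Function using (_∘_)
  open import Relation.Binary.Definitions using (tri<; tri≈; tri>)
  open import Relation.Nullary using (Dec; yes; no; contradiction; ¬?)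
  open import Relation.Nullary.Decidable using (_×-dec_)
  open import Relation.Binary.PropositionalEquality
  open import Algebra.Properties.AbelianGroup +-0-abelianGroup using () renaming (∙-cancelʳ to +-cancelʳ)
  open Congruence m
  open NonNegativity

  x≡y+u⇒u≡x-y : ∀ {x y u} → x ≡ y + u → u ≡ x - y
  x≡y+u⇒u≡x-y {x} {y} {u} eq = trans (isolate y u) (cong (_- y) (sym eq))
    where
    isolate : ∀ y u → u ≡ y + u - y
    isolate = solve-∀

  δ : ℤ
  δ = b - a

  E : ℤ
  E = + 3 * δ + 1ℤ

  -- G ≡ ft (mod m) makes every partner ≡ −ft, and its size pushes F + Low below β (F+low<β).
  G : ℤ
  G = + m * + ∣ b + δ + δ - β ∣ + + ft

  partner : ℤ → ℤ
  partner e = E * (e - b) - G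

  L : ℤ
  L = δ - G

  Clash : ℤ → Set
  Clash y = Any (λ e → Any (λ g → g ≢ e × g + y ≡ e + partner e) F) F

  clash? : ∀ y → Dec (Clash y)
  clash? y = any? (λ e → any? (λ g → ¬? (g ≟ e) ×-dec (g + y ≟ e + partner e)) F) F

  -- The set Y of the proof: dropping the clashes makes e + partner e uniquely represented in F + Low.
  Low : ℤ → Set
  Low y = y ≈ - + ft × y ≤ δ + L × ¬ Clash y

  δ≥0 : NonNeg δ
  δ≥0 = ≤⇒nonNeg (a≤ b∈F)

  E≥0 : NonNeg E
  E≥0 = nonNeg-+ (nonNeg-* (nonNeg-ℕ 3) δ≥0) (nonNeg-ℕ 1)

  b-f≥0 : ∀ {f} → f ∈ F → NonNeg (b - f)
  b-f≥0 = ≤⇒nonNeg ∘ ≤b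

  f-a≥0 : ∀ {f} → f ∈ F → NonNeg (f - a)
  f-a≥0 f∈F = ≤⇒nonNeg (a≤ f∈F)

  -- Distinct partners are at least E = 3δ + 1 apart.
  partner-separated : ∀ {e e' u} → partner e ≡ partner e' + u →
                      NonNeg (+ 3 * δ - u) → NonNeg (+ 3 * δ + u) → e ≡ e'
  partner-separated {e} {e'} {u} eq below above with <-cmp e e'
  ... | tri≈ _ e≡e' _ = e≡e'
  ... | tri< e<e' _ _ = contradiction (subst NonNeg (too-far δ e' e) (subst (λ v → NonNeg (+ 3 * δ + v)) u≡ above))
                                      (¬nonNeg-[-1-x] (nonNeg-* E≥0 (<⇒nonNeg e<e')))
    where
    u≡ : u ≡ - (E * (e' - e))
    u≡ = trans (x≡y+u⇒u≡x-y eq) (difference E e e' b G)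
      where
      difference : ∀ E e e' b G → E * (e - b) - G - (E * (e' - b) - G) ≡ - (E * (e' - e))
      difference = solve-∀
    too-far : ∀ δ e' e → + 3 * δ + - ((+ 3 * δ + 1ℤ) * (e' - e)) ≡ - 1ℤ - (+ 3 * δ + 1ℤ) * (e' - e - 1ℤ)
    too-far = solve-∀
  ... | tri> _ _ e'<e = contradiction (subst NonNeg (too-far δ e e') (subst (λ v → NonNeg (+ 3 * δ - v)) u≡ below))
                                      (¬nonNeg-[-1-x] (nonNeg-* E≥0 (<⇒nonNeg e'<e)))
    where
    u≡ : u ≡ E * (e - e')
    u≡ = trans (x≡y+u⇒u≡x-y eq) (difference E e e' b G)
      where
      difference : ∀ E e e' b G → E * (e - b) - G - (E * (e' - b) - G) ≡ E * (e - e')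
      difference = solve-∀
    too-far : ∀ δ e e' → + 3 * δ - (+ 3 * δ + 1ℤ) * (e - e') ≡ - 1ℤ - (+ 3 * δ + 1ℤ) * (e - e' - 1ℤ)
    too-far = solve-∀

  partner≈ : ∀ {e} → e ∈ F → partner e ≈ - + ft
  partner≈ {e} e∈F = begin
    E * (e - b) - (+ m * + ∣ b + δ + δ - β ∣ + + ft) ≈⟨ ≈-sub (≈-*ˡ E (≈-sub (F≈ft e∈F) (F≈ft b∈F))) (≈-+ (m*k≈0 _) (≈-reflexive refl)) ⟩
    E * (+ ft - + ft) - (0ℤ + + ft)                  ≡⟨ cancel E (+ ft) ⟩
    - + ft                                           ∎
    where
    open ≈-Reasoning
    cancel : ∀ E f → E * (f - f) - (0ℤ + f) ≡ - f
    cancel = solve-∀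

  partner-low : ∀ {e} → e ∈ F → Low (partner e)
  partner-low {e} e∈F = partner≈ e∈F , ≤-from (nonNeg-+ (nonNeg-+ δ≥0 δ≥0) (nonNeg-* E≥0 (b-f≥0 e∈F))) (gap δ E G e b) , no-clash
    where
    gap : ∀ δ E G e b → δ + δ + E * (b - e) ≡ δ + (δ - G) - (E * (e - b) - G)
    gap = solve-∀
    no-clash : ¬ Clash (partner e)
    no-clash clash with find clash
    ... | e' , e'∈F , clash-e' with find clash-e'
    ... | g , g∈F , g≢e' , eq
        with partner-separated {e'} {e} {g - e'} (trans (x≡y+u⇒u≡x-y eq) (shift g (partner e) e'))
               (subst NonNeg (below a b e' g) (nonNeg-+ (nonNeg-+ (nonNeg-+ (f-a≥0 e'∈F) (b-f≥0 g∈F)) δ≥0) δ≥0))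
               (subst NonNeg (above a b e' g) (nonNeg-+ (nonNeg-+ (nonNeg-+ (b-f≥0 e'∈F) (f-a≥0 g∈F)) δ≥0) δ≥0))
      where
      shift : ∀ g p e' → g + p - e' ≡ p + (g - e')
      shift = solve-∀
      below : ∀ a b e' g → (e' - a) + (b - g) + (b - a) + (b - a) ≡ + 3 * (b - a) - (g - e')
      below = solve-∀
      above : ∀ a b e' g → (b - e') + (g - a) + (b - a) + (b - a) ≡ + 3 * (b - a) + (g - e')
      above = solve-∀
    ... | refl = g≢e' (+-cancelʳ (partner e) g e eq)

  low-unique : ∀ {e f y} → e ∈ F → f ∈ F → Low y → f + y ≡ e + partner e → f ≡ e
  low-unique {e} {f} e∈F f∈F (_ , _ , no-clash) eq with f ≟ e
  ... | yes f≡e = f≡e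
  ... | no f≢e  = contradiction (lose e∈F (lose f∈F (f≢e , eq))) no-clash

  -- Every clash lies above partner a - δ, so everything deeper in the right class is low.
  deep-low : ∀ {y} → y ≈ - + ft → y < partner a - δ → Low y
  deep-low {y} y≈ y< = y≈ , <⇒≤ (<-≤-trans y< (≤-from cert (gap a b E G))) , no-clash
    where
    cert : NonNeg (δ + E * δ + δ + δ)
    cert = nonNeg-+ (nonNeg-+ (nonNeg-+ δ≥0 (nonNeg-* E≥0 δ≥0)) δ≥0) δ≥0
    gap : ∀ a b E G → (b - a) + E * (b - a) + (b - a) + (b - a) ≡ (b - a) + ((b - a) - G) - (E * (a - b) - G - (b - a))
    gap = solve-∀
    no-clash : ¬ Clash y
    no-clash clash with find clash
    ... | e , e∈F , clash-e with find clash-e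
    ... | g , g∈F , _ , eq = ≤⇒≯ (≤-from cert' (trans (gap' a b e g E G) (cong (_- (E * (a - b) - G - (b - a))) (sym y≡)))) y<
      where
      y≡ : y ≡ e + partner e - g
      y≡ = x≡y+u⇒u≡x-y (sym eq)
      cert' : NonNeg (E * (e - a) + (e - a) + (b - g))
      cert' = nonNeg-+ (nonNeg-+ (nonNeg-* E≥0 (f-a≥0 e∈F)) (f-a≥0 e∈F)) (b-f≥0 g∈F)
      gap' : ∀ a b e g E G → E * (e - a) + (e - a) + (b - g) ≡ e + (E * (e - b) - G) - g - (E * (a - b) - G - (b - a))
      gap' = solve-∀

  F+low<β : ∀ {f y} → f ∈ F → Low y → f + y < β
  F+low<β {f} {y} f∈F (_ , y≤ , _) =
    <-from (nonNeg-+ (nonNeg-+ (b-f≥0 f∈F) (≤⇒nonNeg y≤))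
                     (nonNeg-+ (nonNeg-+ (nonNeg-* (≤⇒nonNeg (+≤+ (ℕ.>-nonZero⁻¹ m))) (nonNeg-ℕ N)) (nonNeg-∣x∣-x (b + δ + δ - β)))
                               (≤⇒nonNeg (+≤+ (ℕ.>-nonZero⁻¹ ft)))))
           (gap a b f y β (+ m) (+ N) (+ ft))
    where
    N : ℕ
    N = ∣ b + δ + δ - β ∣
    gap : ∀ a b f y β M N ft →
          (b - f) + ((b - a) + ((b - a) - (M * N + ft)) - y) + ((M - 1ℤ) * N + (N - (b + (b - a) + (b - a) - β)) + (ft - 1ℤ))
          ≡ β - (f + y) - 1ℤ
    gap = solve-∀

  +partner≤a+L : ∀ {e} → e ∈ F → e + partner e ≤ a + L
  +partner≤a+L {e} e∈F = ≤-from (nonNeg-+ (b-f≥0 e∈F) (nonNeg-* E≥0 (b-f≥0 e∈F))) (gap a b e E G)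
    where
    gap : ∀ a b e E G → (b - e) + E * (b - e) ≡ a + ((b - a) - G) - (e + (E * (e - b) - G))
    gap = solve-∀

  low-via : ∀ {x f} → x ≈ 0ℤ → f ∈ F → x - f ≤ δ + L → ¬ Clash (x - f) → ((_∈ F) ⊕ Low) x
  low-via {x} {f} x≈0 f∈F x-f≤ ¬clash =
    f , x - f , f∈F , (≈-trans (≈-sub x≈0 (F≈ft f∈F)) (≈-reflexive (+-identityˡ (- + ft))) , x-f≤ , ¬clash) , split x f
    where
    split : ∀ x f → x ≡ f + (x - f)
    split = solve-∀

  -- If both x - a and x - b clash, the two clashes force x = e + partner e.
  double-clash : ∀ {x} → Clash (x - a) → Clash (x - b) → ((_∈ F) ⊕ Low) x
  double-clash {x} clash-a clash-b with find clash-a | find clash-b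
  ... | e , e∈F , clash-ea | e' , e'∈F , clash-e'b with find clash-ea | find clash-e'b
  ... | g , g∈F , _ , eq | g' , g'∈F , _ , eq'
      with partner-separated {e} {e'} {(g - a) + (b - g') + (e' - e)}
             (trans (x≡y+u⇒u≡x-y eq) (trans (shift a b g g' e e' x) (cong (_+ ((g - a) + (b - g') + (e' - e))) (sym (x≡y+u⇒u≡x-y eq')))))
             (subst NonNeg (below a b g g' e e') (nonNeg-+ (nonNeg-+ (nonNeg-+ (b-f≥0 g∈F) (f-a≥0 g'∈F)) (b-f≥0 e'∈F)) (f-a≥0 e∈F)))
             (subst NonNeg (above a b g g' e e')
               (nonNeg-+ (nonNeg-+ (nonNeg-+ (nonNeg-+ (nonNeg-+ (f-a≥0 g∈F) (b-f≥0 g'∈F)) (f-a≥0 e'∈F)) (b-f≥0 e∈F)) δ≥0) δ≥0))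
    where
    shift : ∀ a b g g' e e' x → g + (x - a) - e ≡ g' + (x - b) - e' + ((g - a) + (b - g') + (e' - e))
    shift = solve-∀
    below : ∀ a b g g' e e' → (b - g) + (g' - a) + (b - e') + (e - a) ≡ + 3 * (b - a) - ((g - a) + (b - g') + (e' - e))
    below = solve-∀
    above : ∀ a b g g' e e' → (g - a) + (b - g') + (e' - a) + (b - e) + (b - a) + (b - a) ≡ + 3 * (b - a) + ((g - a) + (b - g') + (e' - e))
    above = solve-∀
  ... | refl = e , partner e , e∈F , partner-low e∈F , x≡
    where
    open ≡-Reasoning
    shift : ∀ x a g → g + (x - a) ≡ (g - a) + x
    shift = solve-∀
    flip : ∀ u v → u - v ≡ - (v - u)
    flip = solve-∀
    g-a≡g'-b : g - a ≡ g' - b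
    g-a≡g'-b = +-cancelʳ x (g - a) (g' - b) (trans (sym (shift x a g)) (trans (trans eq (sym eq')) (shift x b g')))
    g≡a : g ≡ a
    g≡a = ≤-antisym (≤-from (b-f≥0 g'∈F) (trans (flip b g') (trans (cong -_ (sym g-a≡g'-b)) (sym (flip a g))))) (a≤ g∈F)
    split : ∀ x a → x ≡ a + (x - a)
    split = solve-∀
    x≡ : x ≡ e + partner e
    x≡ = begin
      x               ≡⟨ split x a ⟩
      a + (x - a)     ≡⟨ cong (_+ (x - a)) g≡a ⟨
      g + (x - a)     ≡⟨ eq ⟩
      e + partner e   ∎

  low-cover : ∀ {x} → x ≈ 0ℤ → x ≤ b + L → ((_∈ F) ⊕ Low) x
  low-cover {x} x≈0 x≤ with clash? (x - a) | clash? (x - b)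
  ... | no ¬clash  | _          = low-via x≈0 a∈F (≤-from (≤⇒nonNeg x≤) (via-a a b L x)) ¬clash
    where
    via-a : ∀ a b L x → b + L - x ≡ (b - a) + L - (x - a)
    via-a = solve-∀
  ... | yes _      | no ¬clash  = low-via x≈0 b∈F (≤-from (nonNeg-+ (≤⇒nonNeg x≤) δ≥0) (via-b a b L x)) ¬clash
    where
    via-b : ∀ a b L x → b + L - x + (b - a) ≡ (b - a) + L - (x - b)
    via-b = solve-∀
  ... | yes clash-a | yes clash-b = double-clash clash-a clash-b

module Construction
  (m : ℕ) .{{_ : NonZero m}}
  (B : List ℤ) (B⊆mℤ : ∀ b → b ∈ B → multZ m b)
  (F : List ℤ) {f₀ : ℤ} (f₀∈F : f₀ ∈ F)
  (ft : ℕ) .{{_ : NonZero ft}} (F≈ft : ∀ {f} → f ∈ F → Congruence._≈_ m f (+ ft))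
  (n : ℕ) (i₀ : Fin n)
  (S : Fin n → SubsetZ)
  (S⊆ : ∀ z → Σ (Fin n) (λ i → S i z) → multN m z ⊎ z ∈ B)
  (S⊇ : ∀ z → multN m z ⊎ z ∈ B → Σ (Fin n) (λ i → S i z))
  (Wᵢ : Fin n → SubsetZ)
  (Wᵢ-complete : ∀ i z → multZ m z × ¬ S i z → ((_∈ F) ⊕ Wᵢ i) z)
  (Wᵢ-sound : ∀ i z → ((_∈ F) ⊕ Wᵢ i) z → multZ m z × ¬ S i z)
  (slots-fit : ∀ (i : Fin n) → Slots.slot ft (toℕ i) ℕ.+ ft ℕ.< m)
  where
  open import Data.Integer hiding (suc; NonZero)
  open import Data.Integer.Properties
  open import Data.Integer.Tactic.RingSolver using (solve-∀)
  open import Data.Fin.Properties using (toℕ-injective) renaming (any? to anyFin?)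
  open import Data.List.Membership.DecPropositional _≟_ using (_∈?_)
  open import Data.List.Relation.Unary.All using (lookup; tabulate)
  open import Data.List.Extrema ≤-totalOrder using (min; max; min≤⊤; min≤xs; xs≤max; argmin-all; argmax-all)
  open import Function using (id)
  open import Data.Product using (_,_; proj₁; proj₂)
  open import Data.Sum using (inj₁; inj₂)
  open import Relation.Nullary using (yes; no; contradiction)
  open import Relation.Binary.PropositionalEquality
  open import Algebra.Properties.AbelianGroup +-0-abelianGroup using () renaming (∙-cancelˡ to +-cancelˡ)
  import Data.Nat.Properties as ℕ
  open Congruence m
  open Slots ft
  open MinimalComplements

  a b β : ℤ
  a = min f₀ F
  b = max f₀ F
  β = min 0ℤ B

  a≤ : ∀ {f} → f ∈ F → a ≤ f
  a≤ = lookup (min≤xs f₀ F)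

  ≤b : ∀ {f} → f ∈ F → f ≤ b
  ≤b = lookup (xs≤max f₀ F)

  open Sieve m ft F (argmin-all id f₀∈F (tabulate id)) (argmax-all id f₀∈F (tabulate id)) a≤ ≤b F≈ft β

  C₀ C : SubsetZ
  C₀ z = multN m z ⊎ z ∈ B
  C z = multN m z ⊎ z ∈ B ⊎ z ∈ F

  C₀-bounds : ∀ {z} → C₀ z → z ≈ 0ℤ × β ≤ z
  C₀-bounds (inj₁ (k , z≡)) = multZ⇒≈0 (+ k , z≡) , ≤-trans (min≤⊤ 0ℤ B) (multN⇒0≤ (k , z≡))
  C₀-bounds (inj₂ z∈B)      = multZ⇒≈0 (B⊆mℤ _ z∈B) , lookup (min≤xs 0ℤ B) z∈B

  s r : Fin n → ℤ
  s i = + slot (toℕ i)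
  r i = s i + + ft

  slot<m : ∀ i → slot (toℕ i) ℕ.< m
  slot<m i = ℕ.<-trans (ℕ.m<m+n _ (ℕ.>-nonZero⁻¹ ft)) (slots-fit i)

  r≡+ : ∀ i → r i ≡ + (slot (toℕ i) ℕ.+ ft)
  r≡+ i = sym (pos-+ (slot (toℕ i)) ft)

  r-injective : ∀ {i j} → r i ≈ r j → i ≡ j
  r-injective {i} {j} ri≈rj = toℕ-injective (slot-injective (ℕ.+-cancelʳ-≡ ft _ _
    (residue-unique (slots-fit i) (slots-fit j)
      (≈-trans (≈-reflexive (sym (r≡+ i))) (≈-trans ri≈rj (≈-reflexive (r≡+ j)))))))

  r≉s : ∀ i j → ¬ r i ≈ s j
  r≉s i j ri≈sj = slot+ft≢slot (toℕ i) (toℕ j)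
    (residue-unique (slots-fit i) (slot<m j) (≈-trans (≈-reflexive (sym (r≡+ i))) ri≈sj))

  -- Only the part of W_i above L is kept: from F it cannot reach any e + partner e ≤ a + L.
  Shifts : Fin n → SubsetZ
  Shifts i y = (Wᵢ i y × L < y) ⊎ Low y

  Shifts≈ : ∀ {i y} → Shifts i y → y ≈ - + ft
  Shifts≈ (inj₂ (y≈ , _)) = y≈
  Shifts≈ {i} {y} (inj₁ (y∈Wᵢ , _)) = begin
    y              ≡⟨ isolate f₀ y ⟩
    f₀ + y - f₀    ≈⟨ ≈-sub (multZ⇒≈0 (proj₁ (Wᵢ-sound i _ (f₀ , y , f₀∈F , y∈Wᵢ , refl)))) (F≈ft f₀∈F) ⟩
    0ℤ - + ft      ≡⟨ +-identityˡ (- + ft) ⟩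
    - + ft         ∎
    where
    open ≈-Reasoning
    isolate : ∀ f y → y ≡ f + y - f
    isolate = solve-∀

  r+shift≈s : ∀ {i y} → Shifts i y → r i + y ≈ s i
  r+shift≈s {i} {y} y∈ = begin
    s i + + ft + y      ≈⟨ ≈-+ (≈-reflexive {s i + + ft} refl) (Shifts≈ y∈) ⟩
    s i + + ft + - + ft ≡⟨ cancel (s i) (+ ft) ⟩
    s i                 ∎
    where
    open ≈-Reasoning
    cancel : ∀ s f → s + f + - f ≡ s
    cancel = solve-∀

  W : SubsetZ
  W w = Σ (Fin n) (λ j → w ≡ r j ⊎ Σ ℤ (λ y → Shifts j y × w ≡ r j + y))
      ⊎ ((∀ j → ¬ w ≈ r j) × (∀ j → ¬ w ≈ s j))

  via-r : ∀ {i z c} → C c → z - r i ≡ c → (C ⊕ W) z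
  via-r {i} {z} {c} c∈C z-ri≡c = c , r i , c∈C , inj₁ (i , inj₁ refl) , trans (split z (r i)) (cong (_+ r i) z-ri≡c)
    where
    split : ∀ z r → z ≡ z - r + r
    split = solve-∀

  via-shift : ∀ {i z c y} → C c → Shifts i y → z - r i ≡ c + y → (C ⊕ W) z
  via-shift {i} {z} {c} {y} c∈C y∈ z-ri≡ =
    c , r i + y , c∈C , inj₁ (i , inj₂ (y , y∈ , refl)) , trans (split z (r i)) (trans (cong (_+ r i) z-ri≡) (swap c y (r i)))
    where
    split : ∀ z r → z ≡ z - r + r
    split = solve-∀
    swap : ∀ c y r → c + y + r ≡ c + (r + y)
    swap = solve-∀

  cover-r : ∀ i z → z ≈ r i → (C ⊕ W) z
  cover-r i z z≈ri with 0ℤ ≤? z - r i | z - r i ∈? B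
  ... | yes 0≤ | _     = via-r {i} (inj₁ (0≤∧multZ⇒multN 0≤ (multZ-diff z≈ri))) refl
  ... | no _   | yes ∈B = via-r {i} (inj₂ (inj₁ ∈B)) refl
  ... | no ≱0  | no ∉B with Wᵢ-complete i (z - r i) (multZ-diff z≈ri , ∉S)
    where
    ∉S : ¬ S i (z - r i)
    ∉S ∈S with S⊆ _ (i , ∈S)
    ... | inj₁ mN = ≱0 (multN⇒0≤ mN)
    ... | inj₂ ∈B = ∉B ∈B
  ... | f , w , f∈F , w∈Wᵢ , z-ri≡ with L <? w
  ... | yes L<w = via-shift (inj₂ (inj₂ f∈F)) (inj₁ (w∈Wᵢ , L<w)) z-ri≡
  ... | no  L≮w with low-cover (multZ⇒≈0 (multZ-diff z≈ri))
                      (subst (_≤ b + L) (sym z-ri≡) (+-mono-≤ (≤b f∈F) (≮⇒≥ L≮w)))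
  ... | f' , y , f'∈F , y-low , z-ri≡' = via-shift (inj₂ (inj₂ f'∈F)) (inj₂ y-low) z-ri≡'

  cover-s : ∀ i z → z ≈ s i → (C ⊕ W) z
  cover-s i z z≈si = via-shift {i} (inj₁ (k , refl)) (inj₂ (deep-low y≈ deep)) (split (z - r i) (+ m * + k))
    where
    k : ℕ
    k = proj₁ (multiple-below (z - r i) (partner a - δ))
    deep : z - r i - + m * + k < partner a - δ
    deep = proj₂ (multiple-below (z - r i) (partner a - δ))
    split : ∀ x c → x ≡ c + (x - c)
    split = solve-∀
    y≈ : z - r i - + m * + k ≈ - + ft
    y≈ = ≈-trans (≈-sub (≈-sub z≈si (≈-reflexive {r i} refl)) (m*k≈0 (+ k))) (≈-reflexive (cancel (s i) (+ ft)))
      where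
      cancel : ∀ s f → s - (s + f) - 0ℤ ≡ - f
      cancel = solve-∀

  covers : Covers C W
  covers z with anyFin? (λ j → z ≈? r j) | anyFin? (λ j → z ≈? s j)
  ... | yes (i , z≈ri) | _              = cover-r i z z≈ri
  ... | no _           | yes (i , z≈si) = cover-s i z z≈si
  ... | no ≉r          | no ≉s          =
    0ℤ , z , inj₁ (0 , sym (*-zeroʳ (+ m))) , inj₂ ((λ j z≈rj → ≉r (j , z≈rj)) , (λ j z≈sj → ≉s (j , z≈sj))) , sym (+-identityˡ z)

  C⇒C₀⊎F : ∀ {c} → C c → C₀ c ⊎ c ∈ F
  C⇒C₀⊎F (inj₁ c∈mℕ)        = inj₁ (inj₁ c∈mℕ)
  C⇒C₀⊎F (inj₂ (inj₁ c∈B)) = inj₁ (inj₂ c∈B)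
  C⇒C₀⊎F (inj₂ (inj₂ c∈F)) = inj₂ c∈F

  summand-residue : ∀ {i t c w u} → t ≈ 0ℤ → r i + t ≡ c + w → c ≈ u → w ≈ r i - u
  summand-residue {i} t≈0 eq c≈u = ≈-subtract c≈u (≈-trans (≈-reflexive (sym eq)) (≈-+-absorbʳ (r i) t≈0))

  representation-C₀ : ∀ {i t c w} → r i + t ≡ c + w → w ≈ r i → W w → c ≡ t
  representation-C₀ {i} {t} {c} eq w≈ri (inj₁ (j , inj₁ refl)) =
    +-cancelˡ (r i) c t (trans (cong (λ k → r k + c) (sym (r-injective w≈ri))) (trans (+-comm (r j) c) (sym eq)))
  representation-C₀ {i} eq w≈ri (inj₁ (j , inj₂ (y , y∈ , refl))) = contradiction (≈-trans (≈-sym w≈ri) (r+shift≈s y∈)) (r≉s i j)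
  representation-C₀ {i} eq w≈ri (inj₂ (≉r , _)) = contradiction w≈ri (≉r i)

  representation-F : ∀ {i t c w} → r i + t ≡ c + w → w ≈ s i → W w → Σ ℤ λ y → Shifts i y × t ≡ c + y
  representation-F {i} eq w≈si (inj₁ (j , inj₁ refl)) = contradiction w≈si (r≉s j i)
  representation-F {i} {t} {c} eq w≈si (inj₁ (j , inj₂ (y , y∈ , refl))) =
    y , subst (λ k → Shifts k y) j≡i y∈ , +-cancelˡ (r i) t (c + y) (trans eq (trans (swap c (r j) y) (cong (λ k → r k + (c + y)) j≡i)))
    where
    j≡i : j ≡ i
    j≡i = r-injective (≈-+ (≈-trans (≈-sym (r+shift≈s y∈)) w≈si) (≈-reflexive {+ ft} refl))
    swap : ∀ c r y → c + (r + y) ≡ r + (c + y)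
    swap = solve-∀
  representation-F {i} eq w≈si (inj₂ (_ , ≉s)) = contradiction w≈si (≉s i)

  representation : ∀ {i t c w} → t ≈ 0ℤ → r i + t ≡ c + w → C c → W w →
                   (C₀ c × c ≡ t) ⊎ (c ∈ F × Σ ℤ λ y → Shifts i y × t ≡ c + y)
  representation {i} {t} {c} {w} t≈0 eq c∈C w∈W = by-class (C⇒C₀⊎F c∈C)
    where
    cancel : ∀ s f → s + f - f ≡ s
    cancel = solve-∀
    by-class : C₀ c ⊎ c ∈ F → (C₀ c × c ≡ t) ⊎ (c ∈ F × Σ ℤ λ y → Shifts i y × t ≡ c + y)
    by-class (inj₁ c∈C₀) = inj₁ (c∈C₀ , representation-C₀ {c = c} eq
      (≈-trans (summand-residue t≈0 eq (proj₁ (C₀-bounds c∈C₀))) (≈-reflexive (+-identityʳ (r i)))) w∈W)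
    by-class (inj₂ c∈F)  = inj₂ (c∈F , representation-F {c = c} eq
      (≈-trans (summand-residue t≈0 eq (F≈ft c∈F)) (≈-reflexive (cancel (s i) (+ ft)))) w∈W)

  C₀-essential : ∀ {c} → C₀ c → Essential C W c
  C₀-essential {c} c∈C₀ = r i + c , λ c'∈C w∈W eq → only-c (representation c≈0 eq c'∈C w∈W)
    where
    i : Fin n
    i = proj₁ (S⊇ c c∈C₀)
    c≈0 : c ≈ 0ℤ
    c≈0 = proj₁ (C₀-bounds c∈C₀)
    only-c : ∀ {c'} → (C₀ c' × c' ≡ c) ⊎ (c' ∈ F × Σ ℤ λ y → Shifts i y × c ≡ c' + y) → c' ≡ c
    only-c (inj₁ (_ , c'≡c)) = c'≡c
    only-c (inj₂ (c'∈F , y , inj₁ (y∈Wᵢ , _) , c≡)) =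
      contradiction (proj₂ (S⊇ c c∈C₀)) (proj₂ (Wᵢ-sound i c (_ , y , c'∈F , y∈Wᵢ , c≡)))
    only-c (inj₂ (c'∈F , y , inj₂ y-low , c≡)) =
      contradiction (subst (β ≤_) c≡ (proj₂ (C₀-bounds c∈C₀))) (<⇒≱ (F+low<β c'∈F y-low))

  F-essential : ∀ {e} → e ∈ F → Essential C W e
  F-essential {e} e∈F = r i₀ + (e + partner e) , λ c'∈C w∈W eq → only-e (representation e+partner≈0 eq c'∈C w∈W)
    where
    e+partner≈0 : e + partner e ≈ 0ℤ
    e+partner≈0 = ≈-trans (≈-+ (F≈ft e∈F) (partner≈ e∈F)) (≈-reflexive (+-inverseʳ (+ ft)))
    only-e : ∀ {c'} → (C₀ c' × c' ≡ e + partner e) ⊎ (c' ∈ F × Σ ℤ λ y → Shifts i₀ y × e + partner e ≡ c' + y) → c' ≡ e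
    only-e (inj₁ (c'∈C₀ , c'≡)) =
      contradiction (subst (β ≤_) c'≡ (proj₂ (C₀-bounds c'∈C₀))) (<⇒≱ (F+low<β e∈F (partner-low e∈F)))
    only-e (inj₂ (c'∈F , y , inj₁ (_ , L<y) , e+partner≡)) =
      contradiction (subst (_≤ a + L) e+partner≡ (+partner≤a+L e∈F)) (<⇒≱ (+-mono-≤-< (a≤ c'∈F) L<y))
    only-e (inj₂ (c'∈F , y , inj₂ y-low , e+partner≡)) = low-unique e∈F c'∈F y-low (sym e+partner≡)

  isMAC : IsMAC C W
  isMAC = isMAC-if-essential covers essential
    where
    essential : ∀ {c} → C c → Essential C W c
    essential c∈C with C⇒C₀⊎F c∈C
    ... | inj₁ c∈C₀ = C₀-essential c∈C₀
    ... | inj₂ c∈F  = F-essential c∈F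

open import Data.Nat using (ℕ; NonZero; _<_; _≤_; _/_; _%_; _+_; _*_; >-nonZero⁻¹)
open import Data.Nat.Properties using (<-≤-trans)
open import Data.Integer using (ℤ; +_; _-_)
open import Data.Fin using (Fin; fromℕ<)
open import Data.Fin.Properties using (toℕ<n)
open import Data.List using (List)
open import Data.List.Membership.Propositional using (_∈_)
open import Data.Product using (Σ; _×_; _,_; proj₁; proj₂)
open import Data.Sum using (_⊎_)
open import Relation.Nullary using (¬_)
open import Relation.Binary.PropositionalEquality using (_≡_)

theorem4 : (m : ℕ) → .{{_ : NonZero m}} →
  (B : List ℤ) → Σ ℤ (λ b → b ∈ B) → (∀ b → b ∈ B → multZ m b) →
  (F : List ℤ) → Σ ℤ (λ f → f ∈ F) →
  (ft : ℕ) → .{{_ : NonZero ft}} → ft < m →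
  (∀ f → f ∈ F → multZ m (f - (+ ft))) →
  (n : ℕ) → .{{_ : NonZero n}} →
  (S : Fin n → SubsetZ) →
  (∀ z → Σ (Fin n) (λ i → S i z) → (multN m z ⊎ z ∈ B)) →
  (∀ z → (multN m z ⊎ z ∈ B) → Σ (Fin n) (λ i → S i z)) →
  (∀ i → Σ SubsetZ (λ W →
      (∀ z → (multZ m z × ¬ S i z) → ((λ x → x ∈ F) ⊕ W) z) ×
      (∀ z → ((λ x → x ∈ F) ⊕ W) z → (multZ m z × ¬ S i z)))) →
  ft + 2 * ft * (n / ft) + n % ft ≤ m →
  ArisesAsMAC (λ z → multN m z ⊎ z ∈ B ⊎ z ∈ F)
theorem4 m B _ B⊆mℤ F (f₀ , f₀∈F) ft _ F≡ft n S S⊆ S⊇ hW bound = W , isMAC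
  where
  open Construction m B B⊆mℤ F f₀∈F ft (λ {f} f∈F → Congruence.mk≈ (F≡ft f f∈F)) n (fromℕ< (>-nonZero⁻¹ n))
    S S⊆ S⊇ (λ i → proj₁ (hW i)) (λ i → proj₁ (proj₂ (hW i))) (λ i → proj₂ (proj₂ (hW i)))
    (λ i → <-≤-trans (Slots.slot+ft<bound ft (toℕ<n i)) bound)
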